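{- Let $(Q_n)_{n\ge 0}$ be defined by $Q_0=1$, $Q_1=1$, $Q_2=2$ and $Q_n = 5Q_{n-1} - 6Q_{n-2} + Q_{n-3}$ for $n\ge 3$ (so $Q_n$ begins $1,1,2,5,14,42,131,417,\dots$). Then for every $n\ge 0$, \[ Q_n \;=\; 2 \sum_{\substack{k \ge 0\\ k \equiv 0 \ (\mathrm{mod}\ 7)}} \binom{2n}{n+k} \;-\; \sum_{\substack{k\ge 0\\ k \equiv 1,6 \ (\mathrm{mod}\ 7)}} \binom{2n}{n+k} \;-\; \binom{2n}{n}. \]
   Context: Binomial coefficients $\binom{m}{i}$ are taken to be $0$ for $i<0$ and for $i>m$. The sequence is OEIS A080937, which the paper describes via the Binet-type formula $Q_n = c_1(2\cos\frac{\pi}{7})^{2n}+c_2(2\cos\frac{2\pi}{7})^{2n}+c_3(2\cos\frac{3\pi}{7})^{2n}$ for suitable constants $c_1,c_2,c_3$. -}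

module Defs where

open import Data.Nat using (ℕ; zero; suc; _+_; _*_; _%_)
open import Data.Nat.Combinatorics using (_C_)
open import Data.Integer using (ℤ; +_) renaming (_+_ to _+ℤ_; _-_ to _-ℤ_; _*_ to _*ℤ_)
open import Data.List using (List; upTo; map; filter)
open import Data.Nat.ListAction using () renaming (sum to sumℕ)
open import Data.Nat using (_≟_)
open import Relation.Nullary.Decidable using (_⊎-dec_)

Q : ℕ → ℤ
Q 0 = + 1
Q 1 = + 1
Q 2 = + 2
Q (suc (suc (suc n))) =
  ((+ 5) *ℤ Q (suc (suc n)) -ℤ (+ 6) *ℤ Q (suc n)) +ℤ Q n

-- Σ_{0 ≤ k ≤ n, k ≡ 0 (mod 7)} C(2n, n+k).  (Terms with k > n vanish.)
S0 : ℕ → ℕ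
S0 n = sumℕ (map (λ k → (2 * n) C (n + k))
                 (filter (λ k → k % 7 ≟ 0) (upTo (suc n))))

S16 : ℕ → ℕ
S16 n = sumℕ (map (λ k → (2 * n) C (n + k))
                  (filter (λ k → (k % 7 ≟ 1) ⊎-dec (k % 7 ≟ 6)) (upTo (suc n))))

-- Write the right-hand side as Σ_{k ≥ 0} w_k C(2n, n+k) for a 7-periodic weight w.
-- Passing from row 2n to row 2n+2 of Pascal's triangle replaces w by its symmetric
-- convolution with (1, 2, 1), i.e. multiplies the even two-sided weight by x + 2 + x⁻¹.
-- On the character k ↦ ζ^k (ζ⁷ = 1) this is multiplication by 2 + ζ + ζ⁻¹, which runs
-- through the roots (2 cos(πj/7))² of x³ − 5x² + 6x − 1. Hence three convolutions of w
-- obey the recurrence of Q pointwise, so the row sums obey it too, and they agree with Q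
-- on the initial values.
module Submission where

open import Defs
open import Data.Bool using (Bool; true; false)
open import Data.Integer using (ℤ; +_; -[1+_]; _+_; _*_; _-_; -_)
open import Data.Integer.Properties
  using (+-comm; +-identityˡ; +-identityʳ; pos-+; pos-*; *-zeroʳ; *-identityˡ)
open import Data.Integer.Tactic.RingSolver using (solve-∀)
open import Data.List using (applyUpTo; map; filter)
import Data.Nat as ℕ
open ℕ using (ℕ; zero; suc; _%_; _≟_)
import Data.Nat.Properties as ℕₚ
import Data.Nat.Tactic.RingSolver as ℕ-RingSolver
open import Data.Nat.Combinatorics
  using (_C_; nCk≡nC[n∸k]; nCk+nC[k+1]≡[n+1]C[k+1]; k>n⇒nCk≡0)
open import Data.Nat.DivMod using ([m+n]%n≡m%n)
open import Data.Nat.ListAction using () renaming (sum to sumℕ)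
open import Relation.Nullary using (does)
open import Relation.Nullary.Decidable using (_⊎-dec_)
open import Relation.Unary using (Pred; Decidable)
open import Relation.Binary.PropositionalEquality
  using (_≡_; refl; sym; trans; cong; cong₂; subst; module ≡-Reasoning)

∑ : ℕ → (ℕ → ℤ) → ℤ
∑ zero    f = + 0
∑ (suc N) f = f 0 + ∑ N (λ k → f (suc k))

∑-last : ∀ N (f : ℕ → ℤ) → ∑ (suc N) f ≡ ∑ N f + f N
∑-last zero    f = +-comm (f 0) (+ 0)
∑-last (suc N) f = trans (cong (_+_ (f 0)) (∑-last N (λ k → f (suc k)))) (assoc (f 0) _ _)
  where
  assoc : ∀ x y z → x + (y + z) ≡ (x + y) + z
  assoc = solve-∀

∑-dropLast : ∀ N (f : ℕ → ℤ) → f N ≡ + 0 → ∑ (suc N) f ≡ ∑ N f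
∑-dropLast N f fN≡0 =
  trans (∑-last N f) (trans (cong (_+_ (∑ N f)) fN≡0) (+-identityʳ (∑ N f)))

∑-linear : ∀ N a b (f g : ℕ → ℤ) {F : ℕ → ℤ} → (∀ k → F k ≡ a * f k + b * g k) →
           ∑ N F ≡ a * ∑ N f + b * ∑ N g
∑-linear zero a b f g F≡ = vanish a b
  where
  vanish : ∀ a b → + 0 ≡ a * + 0 + b * + 0
  vanish = solve-∀
∑-linear (suc N) a b f g F≡ =
  trans (cong₂ _+_ (F≡ 0) (∑-linear N a b f′ g′ (λ k → F≡ (suc k))))
        (regroup a b (f 0) (g 0) (∑ N f′) (∑ N g′))
  where
  f′ g′ : ℕ → ℤ
  f′ k = f (suc k)
  g′ k = g (suc k)
  regroup : ∀ a b x y s t → (a * x + b * y) + (a * s + b * t) ≡ a * (x + s) + b * (y + t)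
  regroup = solve-∀

∑-linear₃ : ∀ N a b c (f g h : ℕ → ℤ) {F : ℕ → ℤ} →
            (∀ k → F k ≡ a * f k + b * g k + c * h k) →
            ∑ N F ≡ a * ∑ N f + b * ∑ N g + c * ∑ N h
∑-linear₃ zero a b c f g h F≡ = vanish a b c
  where
  vanish : ∀ a b c → + 0 ≡ a * + 0 + b * + 0 + c * + 0
  vanish = solve-∀
∑-linear₃ (suc N) a b c f g h F≡ =
  trans (cong₂ _+_ (F≡ 0) (∑-linear₃ N a b c f′ g′ h′ (λ k → F≡ (suc k))))
        (regroup a b c (f 0) (g 0) (h 0) (∑ N f′) (∑ N g′) (∑ N h′))
  where
  f′ g′ h′ : ℕ → ℤ
  f′ k = f (suc k)
  g′ k = g (suc k)
  h′ k = h (suc k)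
  regroup : ∀ a b c x y z s t u →
            (a * x + b * y + c * z) + (a * s + b * t + c * u)
              ≡ a * (x + s) + b * (y + t) + c * (z + u)
  regroup = solve-∀

pascal : ∀ m k → + (suc m C suc k) ≡ + (m C k) + + (m C suc k)
pascal m k =
  trans (cong +_ (sym (nCk+nC[k+1]≡[n+1]C[k+1] m k))) (pos-+ (m C k) (m C suc k))

pascal² : ∀ m k → + (suc (suc m) C suc (suc k))
                    ≡ + (m C k) + (+ 2 * + (m C suc k) + + (m C suc (suc k)))
pascal² m k = begin
  + (suc (suc m) C suc (suc k))
    ≡⟨ pascal (suc m) (suc k) ⟩
  + (suc m C suc k) + + (suc m C suc (suc k))
    ≡⟨ cong₂ _+_ (pascal m k) (pascal m (suc k)) ⟩
  (+ (m C k) + + (m C suc k)) + (+ (m C suc k) + + (m C suc (suc k)))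
    ≡⟨ collect (+ (m C k)) (+ (m C suc k)) (+ (m C suc (suc k))) ⟩
  + (m C k) + (+ 2 * + (m C suc k) + + (m C suc (suc k)))
    ∎
  where
  open ≡-Reasoning
  collect : ∀ x y z → (x + y) + (y + z) ≡ x + (+ 2 * y + z)
  collect = solve-∀

C-middle : ∀ n → suc (2 ℕ.* n) C n ≡ suc (2 ℕ.* n) C suc n
C-middle n = trans (nCk≡nC[n∸k] n≤2n+1) (cong (suc (2 ℕ.* n) C_) 2n+1∸n≡n+1)
  where
  split : ∀ n → suc (2 ℕ.* n) ≡ n ℕ.+ suc n
  split = ℕ-RingSolver.solve-∀
  n≤2n+1 : n ℕ.≤ suc (2 ℕ.* n)
  n≤2n+1 = subst (n ℕ.≤_) (sym (split n)) (ℕₚ.m≤m+n n (suc n))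
  2n+1∸n≡n+1 : suc (2 ℕ.* n) ℕ.∸ n ≡ suc n
  2n+1∸n≡n+1 = trans (cong (ℕ._∸ n) (split n)) (ℕₚ.m+n∸m≡n n (suc n))

row : ℕ → ℕ → ℤ
row n k = + ((2 ℕ.* n) C (n ℕ.+ k))

row-vanishes : ∀ n j → row n (j ℕ.+ suc n) ≡ + 0
row-vanishes n j = cong +_ (k>n⇒nCk≡0 2n<n+[j+n+1])
  where
  index : ∀ n j → n ℕ.+ (j ℕ.+ suc n) ≡ suc (2 ℕ.* n ℕ.+ j)
  index = ℕ-RingSolver.solve-∀
  2n<n+[j+n+1] : 2 ℕ.* n ℕ.< n ℕ.+ (j ℕ.+ suc n)
  2n<n+[j+n+1] = subst (2 ℕ.* n ℕ.<_) (sym (index n j)) (ℕ.s≤s (ℕₚ.m≤m+n (2 ℕ.* n) j))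

row-suc-zero : ∀ n → row (suc n) 0 ≡ + 2 * row n 0 + + 2 * row n 1
row-suc-zero n = begin
  row (suc n) 0
    ≡⟨ cong₂ (λ a b → + (a C b)) (ℕₚ.*-suc 2 n) (cong suc (ℕₚ.+-identityʳ n)) ⟩
  + (suc (suc m) C suc n)
    ≡⟨ pascal (suc m) n ⟩
  + (suc m C n) + + (suc m C suc n)
    ≡⟨ cong (λ a → + a + + (suc m C suc n)) (C-middle n) ⟩
  + (suc m C suc n) + + (suc m C suc n)
    ≡⟨ cong (λ a → a + a) (pascal m n) ⟩
  (+ (m C n) + + (m C suc n)) + (+ (m C n) + + (m C suc n))
    ≡⟨ double (+ (m C n)) (+ (m C suc n)) ⟩
  + 2 * + (m C n) + + 2 * + (m C suc n)
    ≡⟨ cong₂ (λ a b → + 2 * + (m C a) + + 2 * + (m C b))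
             (sym (ℕₚ.+-identityʳ n)) (sym (ℕₚ.+-comm n 1)) ⟩
  + 2 * row n 0 + + 2 * row n 1
    ∎
  where
  open ≡-Reasoning
  m : ℕ
  m = 2 ℕ.* n
  double : ∀ x y → (x + y) + (x + y) ≡ + 2 * x + + 2 * y
  double = solve-∀

row-suc-suc : ∀ n k → row (suc n) (suc k) ≡ row n k + (+ 2 * row n (suc k) + row n (suc (suc k)))
row-suc-suc n k = begin
  row (suc n) (suc k)
    ≡⟨ cong₂ (λ a b → + (a C b)) (ℕₚ.*-suc 2 n) (cong suc (ℕₚ.+-suc n k)) ⟩
  + (suc (suc m) C suc (suc (n ℕ.+ k)))
    ≡⟨ pascal² m (n ℕ.+ k) ⟩
  + (m C (n ℕ.+ k)) + (+ 2 * + (m C suc (n ℕ.+ k)) + + (m C suc (suc (n ℕ.+ k))))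
    ≡⟨ cong₂ (λ a b → + (m C (n ℕ.+ k)) + (+ 2 * + (m C a) + + (m C b)))
             (sym (ℕₚ.+-suc n k))
             (sym (trans (ℕₚ.+-suc n (suc k)) (cong suc (ℕₚ.+-suc n k)))) ⟩
  row n k + (+ 2 * row n (suc k) + row n (suc (suc k)))
    ∎
  where
  open ≡-Reasoning
  m : ℕ
  m = 2 ℕ.* n

-- The last term, k = n + 1, vanishes; it is kept so that the ranges in
-- weightedRow-pascalStep line up without a case split on n.
weightedRow : ℕ → (ℕ → ℤ) → ℤ
weightedRow n v = ∑ (suc (suc n)) (λ k → v k * row n k)

-- A weight v on k ≥ 0 encodes the even weight W on ℤ with W 0 = v 0 and W (± k) = v k / 2.
-- pascalStep v encodes k ↦ W (k − 1) + 2 W k + W (k + 1), whence the factor 2 at k = 1.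
lowerNeighbour : (ℕ → ℤ) → ℕ → ℤ
lowerNeighbour v zero          = + 0
lowerNeighbour v (suc zero)    = + 2 * v 0
lowerNeighbour v (suc (suc k)) = v (suc k)

pascalStep : (ℕ → ℤ) → ℕ → ℤ
pascalStep v k = lowerNeighbour v k + + 2 * v k + v (suc k)

weightedRow-pascalStep : ∀ n v → weightedRow (suc n) v ≡ weightedRow n (pascalStep v)
weightedRow-pascalStep n v = begin
  weightedRow (suc n) v
    ≡⟨ cong₂ _+_ (cong (_*_ (v 0)) (row-suc-zero n))
                 (∑-linear₃ (suc (suc n)) (+ 1) (+ 2) (+ 1) a b g expand) ⟩
  v 0 * (+ 2 * r 0 + + 2 * r 1) + (+ 1 * A + + 2 * ∑ (suc (suc n)) b + + 1 * ∑ (suc (suc n)) g)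
    ≡⟨ cong₂ (λ x y → v 0 * (+ 2 * r 0 + + 2 * r 1) + (+ 1 * A + + 2 * x + + 1 * y))
             b-tail g-tail ⟩
  v 0 * (+ 2 * r 0 + + 2 * r 1) + (+ 1 * A + + 2 * ∑ (suc n) b + + 1 * ∑ n g)
    ≡⟨ rearrange (v 0) (r 0) (r 1) A (∑ (suc n) b) (∑ n g) ⟩
  + 1 * (+ 0 * r 0 + (+ 2 * v 0 * r 1 + ∑ n g)) + + 2 * (v 0 * r 0 + ∑ (suc n) b) + + 1 * A
    ≡⟨ sym (∑-linear₃ (suc (suc n)) (+ 1) (+ 2) (+ 1)
                      (λ k → lowerNeighbour v k * r k) (λ k → v k * r k) a collect) ⟩
  weightedRow n (pascalStep v)
    ∎
  where
  open ≡-Reasoning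
  r a b g : ℕ → ℤ
  r = row n
  a k = v (suc k) * r k
  b k = v (suc k) * r (suc k)
  g k = v (suc k) * r (suc (suc k))
  A : ℤ
  A = ∑ (suc (suc n)) a

  expand : ∀ k → v (suc k) * row (suc n) (suc k) ≡ + 1 * a k + + 2 * b k + + 1 * g k
  expand k = trans (cong (_*_ (v (suc k))) (row-suc-suc n k))
                   (distrib (v (suc k)) (r k) (r (suc k)) (r (suc (suc k))))
    where
    distrib : ∀ x p q s → x * (p + (+ 2 * q + s)) ≡ + 1 * (x * p) + + 2 * (x * q) + + 1 * (x * s)
    distrib = solve-∀

  collect : ∀ k → pascalStep v k * r k
                    ≡ + 1 * (lowerNeighbour v k * r k) + + 2 * (v k * r k) + + 1 * a k
  collect k = distrib (lowerNeighbour v k) (v k) (v (suc k)) (r k)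
    where
    distrib : ∀ x y z p → (x + + 2 * y + z) * p ≡ + 1 * (x * p) + + 2 * (y * p) + + 1 * (z * p)
    distrib = solve-∀

  vanishing : ∀ j x → x * row n (j ℕ.+ suc n) ≡ + 0
  vanishing j x = trans (cong (_*_ x) (row-vanishes n j)) (*-zeroʳ x)

  b-tail : ∑ (suc (suc n)) b ≡ ∑ (suc n) b
  b-tail = ∑-dropLast (suc n) b (vanishing 1 (v (suc (suc n))))

  g-tail : ∑ (suc (suc n)) g ≡ ∑ n g
  g-tail = trans (∑-dropLast (suc n) g (vanishing 2 (v (suc (suc n)))))
                 (∑-dropLast n g (vanishing 1 (v (suc n))))

  rearrange : ∀ w₀ r₀ r₁ a s t →
    w₀ * (+ 2 * r₀ + + 2 * r₁) + (+ 1 * a + + 2 * s + + 1 * t)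
      ≡ + 1 * (+ 0 * r₀ + (+ 2 * w₀ * r₁ + t)) + + 2 * (w₀ * r₀ + s) + + 1 * a
  rearrange = solve-∀

Recurrent : (ℕ → ℤ) → Set
Recurrent u = ∀ n → u (suc (suc (suc n))) ≡ + 5 * u (suc (suc n)) - + 6 * u (suc n) + u n

Recurrent-unique : ∀ {u v} → Recurrent u → Recurrent v →
                   u 0 ≡ v 0 → u 1 ≡ v 1 → u 2 ≡ v 2 → ∀ n → u n ≡ v n
Recurrent-unique ru rv e₀ e₁ e₂ 0 = e₀
Recurrent-unique ru rv e₀ e₁ e₂ 1 = e₁
Recurrent-unique ru rv e₀ e₁ e₂ 2 = e₂
Recurrent-unique {u} {v} ru rv e₀ e₁ e₂ (suc (suc (suc n))) = begin
  u (suc (suc (suc n)))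
    ≡⟨ ru n ⟩
  + 5 * u (suc (suc n)) - + 6 * u (suc n) + u n
    ≡⟨ cong₂ _+_
         (cong₂ _-_ (cong (_*_ (+ 5)) (Recurrent-unique {u} {v} ru rv e₀ e₁ e₂ (suc (suc n))))
                    (cong (_*_ (+ 6)) (Recurrent-unique {u} {v} ru rv e₀ e₁ e₂ (suc n))))
         (Recurrent-unique {u} {v} ru rv e₀ e₁ e₂ n) ⟩
  + 5 * v (suc (suc n)) - + 6 * v (suc n) + v n
    ≡⟨ sym (rv n) ⟩
  v (suc (suc (suc n)))
    ∎
  where open ≡-Reasoning

weightedRow-recurrent : ∀ v →
  (∀ k → pascalStep (pascalStep (pascalStep v)) k
           ≡ + 5 * pascalStep (pascalStep v) k - + 6 * pascalStep v k + v k) →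
  Recurrent (λ n → weightedRow n v)
weightedRow-recurrent v annihilated n = begin
  weightedRow (suc (suc (suc n))) v
    ≡⟨ trans (weightedRow-pascalStep (suc (suc n)) v) (two-steps (pascalStep v)) ⟩
  weightedRow n (pascalStep P²)
    ≡⟨ ∑-linear₃ (suc (suc n)) (+ 5) (- (+ 6)) (+ 1)
                 (λ k → P² k * row n k) (λ k → P¹ k * row n k) (λ k → v k * row n k) expand ⟩
  + 5 * weightedRow n P² + - (+ 6) * weightedRow n P¹ + + 1 * weightedRow n v
    ≡⟨ cong₂ (λ x y → + 5 * x + - (+ 6) * y + + 1 * weightedRow n v)
             (sym (two-steps v)) (sym (weightedRow-pascalStep n v)) ⟩
  + 5 * weightedRow (suc (suc n)) v + - (+ 6) * weightedRow (suc n) v + + 1 * weightedRow n v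
    ≡⟨ normalise (weightedRow (suc (suc n)) v) (weightedRow (suc n) v) (weightedRow n v) ⟩
  + 5 * weightedRow (suc (suc n)) v - + 6 * weightedRow (suc n) v + weightedRow n v
    ∎
  where
  open ≡-Reasoning
  P¹ P² : ℕ → ℤ
  P¹ = pascalStep v
  P² = pascalStep P¹

  two-steps : ∀ u → weightedRow (suc (suc n)) u ≡ weightedRow n (pascalStep (pascalStep u))
  two-steps u = trans (weightedRow-pascalStep (suc n) u) (weightedRow-pascalStep n (pascalStep u))

  distrib : ∀ x y z p → (+ 5 * x - + 6 * y + z) * p ≡ + 5 * (x * p) + - (+ 6) * (y * p) + + 1 * (z * p)
  distrib = solve-∀

  expand : ∀ k → pascalStep P² k * row n k
                   ≡ + 5 * (P² k * row n k) + - (+ 6) * (P¹ k * row n k) + + 1 * (v k * row n k)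
  expand k = trans (cong (λ x → x * row n k) (annihilated k)) (distrib (P² k) (P¹ k) (v k) (row n k))

  normalise : ∀ x y z → + 5 * x + - (+ 6) * y + + 1 * z ≡ + 5 * x - + 6 * y + z
  normalise = solve-∀

-- weight 0 = 2 − 1: the k = 0 term enters 2 S0 and is subtracted once more as C(2n, n).
weight : ℕ → ℤ
weight 0 = + 1
weight 1 = -[1+ 0 ]
weight 2 = + 0
weight 3 = + 0
weight 4 = + 0
weight 5 = + 0
weight 6 = -[1+ 0 ]
weight 7 = + 2
weight (suc (suc (suc (suc (suc (suc (suc (suc k)))))))) = weight (suc k)

-- Three steps at k read weight (k − 3) … weight (k + 3), a 7-periodic window once k ≥ 4,
-- so the cases k ≤ 10 cover one full period.
weight-recurrence : ∀ k → pascalStep (pascalStep (pascalStep weight)) k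
                          ≡ + 5 * pascalStep (pascalStep weight) k - + 6 * pascalStep weight k + weight k
weight-recurrence 0  = refl
weight-recurrence 1  = refl
weight-recurrence 2  = refl
weight-recurrence 3  = refl
weight-recurrence 4  = refl
weight-recurrence 5  = refl
weight-recurrence 6  = refl
weight-recurrence 7  = refl
weight-recurrence 8  = refl
weight-recurrence 9  = refl
weight-recurrence 10 = refl
weight-recurrence (suc (suc (suc (suc (suc (suc (suc (suc (suc (suc (suc k))))))))))) =
  weight-recurrence (suc (suc (suc (suc k))))

Q≡weightedRow : ∀ n → Q n ≡ weightedRow n weight
Q≡weightedRow =
  Recurrent-unique (λ n → refl) (weightedRow-recurrent weight weight-recurrence) refl refl refl

𝟙 : Bool → ℤ
𝟙 true  = + 1
𝟙 false = + 0

sum-filter : ∀ {p} {P : Pred ℕ p} (P? : Decidable P) (h g : ℕ → ℕ) N →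
  + sumℕ (map h (filter P? (applyUpTo g N))) ≡ ∑ N (λ k → 𝟙 (does (P? (g k))) * + h (g k))
sum-filter P? h g zero = refl
sum-filter P? h g (suc N) with does (P? (g 0))
... | true  = trans (pos-+ (h (g 0)) _)
                    (cong₂ _+_ (sym (*-identityˡ (+ h (g 0)))) (sum-filter P? h (λ k → g (suc k)) N))
... | false = trans (sum-filter P? h (λ k → g (suc k)) N) (sym (+-identityˡ _))

χ₀ χ₁₆ residueWeight : ℕ → ℤ
χ₀ r = 𝟙 (does (r ≟ 0))
χ₁₆ r = 𝟙 (does ((r ≟ 1) ⊎-dec (r ≟ 6)))
residueWeight r = + 2 * χ₀ r - χ₁₆ r

weight-residue : ∀ m → weight (suc m) ≡ residueWeight (suc m % 7)
weight-residue 0 = refl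
weight-residue 1 = refl
weight-residue 2 = refl
weight-residue 3 = refl
weight-residue 4 = refl
weight-residue 5 = refl
weight-residue 6 = refl
weight-residue (suc (suc (suc (suc (suc (suc (suc m))))))) =
  trans (weight-residue m) (cong residueWeight (sym period))
  where
  period : (7 ℕ.+ suc m) % 7 ≡ suc m % 7
  period = trans (cong (_% 7) (ℕₚ.+-comm 7 (suc m))) ([m+n]%n≡m%n (suc m) 7)

weightedRow-weight : ∀ n → weightedRow n weight ≡ + 2 * + S0 n - + S16 n - row n 0
weightedRow-weight n = begin
  weightedRow n weight
    ≡⟨ cong (_+_ (+ 1 * row n 0)) (∑-dropLast n (λ k → weight (suc k) * row n (suc k)) last≡0) ⟩
  + 1 * row n 0 + ∑ n (λ k → weight (suc k) * row n (suc k))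
    ≡⟨ cong (_+_ (+ 1 * row n 0)) (∑-linear n (+ 2) (- (+ 1)) s₀′ s₁₆′ split) ⟩
  + 1 * row n 0 + (+ 2 * ∑ n s₀′ + - (+ 1) * ∑ n s₁₆′)
    ≡⟨ rearrange (row n 0) (∑ n s₀′) (∑ n s₁₆′) ⟩
  + 2 * ∑ (suc n) s₀ - ∑ (suc n) s₁₆ - row n 0
    ≡⟨ cong₂ (λ x y → + 2 * x - y - row n 0) (sym S0≡∑) (sym S16≡∑) ⟩
  + 2 * + S0 n - + S16 n - row n 0
    ∎
  where
  open ≡-Reasoning
  s₀ s₁₆ s₀′ s₁₆′ : ℕ → ℤ
  s₀ k = χ₀ (k % 7) * row n k
  s₁₆ k = χ₁₆ (k % 7) * row n k
  s₀′ k = s₀ (suc k)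
  s₁₆′ k = s₁₆ (suc k)

  binomial : ℕ → ℕ
  binomial k = (2 ℕ.* n) C (n ℕ.+ k)

  S0≡∑ : + S0 n ≡ ∑ (suc n) s₀
  S0≡∑ = sum-filter (λ k → k % 7 ≟ 0) binomial (λ k → k) (suc n)

  S16≡∑ : + S16 n ≡ ∑ (suc n) s₁₆
  S16≡∑ = sum-filter (λ k → (k % 7 ≟ 1) ⊎-dec (k % 7 ≟ 6)) binomial (λ k → k) (suc n)

  last≡0 : weight (suc n) * row n (suc n) ≡ + 0
  last≡0 = trans (cong (_*_ (weight (suc n))) (row-vanishes n 0)) (*-zeroʳ (weight (suc n)))

  distrib : ∀ x y p → (+ 2 * x - y) * p ≡ + 2 * (x * p) + - (+ 1) * (y * p)
  distrib = solve-∀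

  split : ∀ k → weight (suc k) * row n (suc k) ≡ + 2 * s₀′ k + - (+ 1) * s₁₆′ k
  split k = trans (cong (λ x → x * row n (suc k)) (weight-residue k))
                  (distrib (χ₀ (suc k % 7)) (χ₁₆ (suc k % 7)) (row n (suc k)))

  rearrange : ∀ r x y → + 1 * r + (+ 2 * x + - (+ 1) * y) ≡ + 2 * (+ 1 * r + x) - (+ 0 * r + y) - r
  rearrange = solve-∀

mainTheorem5 : (n : ℕ) →
    Q n ≡ ((+ (2 ℕ.* S0 n) - + (S16 n)) - + ((2 ℕ.* n) C n))
mainTheorem5 n = begin
  Q n                                            ≡⟨ Q≡weightedRow n ⟩
  weightedRow n weight                           ≡⟨ weightedRow-weight n ⟩
  + 2 * + S0 n - + S16 n - row n 0               ≡⟨ cong₂ (λ x k → x - + S16 n - + ((2 ℕ.* n) C k))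
                                                          (sym (pos-* 2 (S0 n))) (ℕₚ.+-identityʳ n) ⟩
  + (2 ℕ.* S0 n) - + S16 n - + ((2 ℕ.* n) C n)   ∎
  where open ≡-Reasoning
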